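{- Let $(\mathbb{A},\mathcal{A})$ be a Boolean kit and $a\in\mathbb{A}$. Then $\mathcal{A}(a)$ is closed under subgroups (in particular $\{\mathrm{id}_a\}\in\mathcal{A}(a)$) and under unions of directed subsets.
   Context: A kit on a groupoid $\mathbb{A}$ is a family $\mathcal{A}(a)$ of sets of subgroups of $\mathrm{End}(a)=\mathbb{A}(a,a)$ closed under conjugation. Subgroups $H,K$ of $\mathrm{End}(a)$ are orthogonal if $H\cap K=\{\mathrm{id}_a\}$; $\mathcal{A}^\perp$ is the kit on $\mathbb{A}^{op}$ with $\mathcal{A}^\perp(a)$ the set of subgroups orthogonal to every member of $\mathcal{A}(a)$. A kit is Boolean if $\mathcal{A}=\mathcal{A}^{\perp\perp}$. -}

module Defs where

open import Level using (Level; _⊔_; suc)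
open import Data.Product using (Σ; _×_; _,_; proj₁; proj₂)
open import Function.Bundles using (_⇔_)
open import Relation.Binary.PropositionalEquality
  using (_≡_; refl; sym; trans; cong; cong₂; subst; module ≡-Reasoning)

record Groupoid (o h : Level) : Set (suc (o ⊔ h)) where
  infixr 9 _∘_
  field
    Ob    : Set o
    Hom   : Ob → Ob → Set h
    id    : ∀ {a} → Hom a a
    _∘_   : ∀ {a b c} → Hom b c → Hom a b → Hom a c
    _⁻¹   : ∀ {a b} → Hom a b → Hom b a
    assoc : ∀ {a b c d} (f : Hom c d) (g : Hom b c) (k : Hom a b) →
            (f ∘ g) ∘ k ≡ f ∘ (g ∘ k)
    idˡ   : ∀ {a b} (f : Hom a b) → id ∘ f ≡ f
    idʳ   : ∀ {a b} (f : Hom a b) → f ∘ id ≡ f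
    invˡ  : ∀ {a b} (f : Hom a b) → (f ⁻¹) ∘ f ≡ id
    invʳ  : ∀ {a b} (f : Hom a b) → f ∘ (f ⁻¹) ≡ id

module GroupoidTheory {o h : Level} (𝔸 : Groupoid o h) where
  open Groupoid 𝔸
  open ≡-Reasoning

  inv-unique : ∀ {a b} (f : Hom a b) (g : Hom b a) → g ∘ f ≡ id → g ≡ f ⁻¹
  inv-unique f g p = begin
    g                 ≡⟨ sym (idʳ g) ⟩
    g ∘ id            ≡⟨ cong (g ∘_) (sym (invʳ f)) ⟩
    g ∘ (f ∘ f ⁻¹)    ≡⟨ sym (assoc g f (f ⁻¹)) ⟩
    (g ∘ f) ∘ f ⁻¹    ≡⟨ cong (_∘ f ⁻¹) p ⟩
    id ∘ f ⁻¹         ≡⟨ idˡ (f ⁻¹) ⟩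
    f ⁻¹              ∎

  cj : ∀ {a b} → Hom a b → Hom b b → Hom a a
  cj g y = g ⁻¹ ∘ (y ∘ g)

  cj-id : ∀ {a b} (g : Hom a b) → cj g id ≡ id
  cj-id g = trans (cong (g ⁻¹ ∘_) (idˡ g)) (invˡ g)

  cj-∘ : ∀ {a b} (g : Hom a b) (x y : Hom b b) → cj g (x ∘ y) ≡ cj g x ∘ cj g y
  cj-∘ g x y = sym (begin
    (g ⁻¹ ∘ (x ∘ g)) ∘ (g ⁻¹ ∘ (y ∘ g))   ≡⟨ assoc (g ⁻¹) (x ∘ g) _ ⟩
    g ⁻¹ ∘ ((x ∘ g) ∘ (g ⁻¹ ∘ (y ∘ g)))   ≡⟨ cong (g ⁻¹ ∘_) (assoc x g _) ⟩
    g ⁻¹ ∘ (x ∘ (g ∘ (g ⁻¹ ∘ (y ∘ g))))   ≡⟨ cong (λ z → g ⁻¹ ∘ (x ∘ z)) (sym (assoc g (g ⁻¹) (y ∘ g))) ⟩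
    g ⁻¹ ∘ (x ∘ ((g ∘ g ⁻¹) ∘ (y ∘ g)))   ≡⟨ cong (λ z → g ⁻¹ ∘ (x ∘ (z ∘ (y ∘ g)))) (invʳ g) ⟩
    g ⁻¹ ∘ (x ∘ (id ∘ (y ∘ g)))           ≡⟨ cong (λ z → g ⁻¹ ∘ (x ∘ z)) (idˡ (y ∘ g)) ⟩
    g ⁻¹ ∘ (x ∘ (y ∘ g))                  ≡⟨ cong (g ⁻¹ ∘_) (sym (assoc x y g)) ⟩
    g ⁻¹ ∘ ((x ∘ y) ∘ g)                  ∎)

  cj-⁻¹ : ∀ {a b} (g : Hom a b) (x : Hom b b) → cj g (x ⁻¹) ≡ (cj g x) ⁻¹
  cj-⁻¹ g x = inv-unique (cj g x) (cj g (x ⁻¹))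
    (trans (sym (cj-∘ g (x ⁻¹) x)) (trans (cong (cj g) (invˡ x)) (cj-id g)))

module _ {o h : Level} (𝔸 : Groupoid o h) where
  open Groupoid 𝔸
  open GroupoidTheory 𝔸

  record Subgroup (ℓ : Level) (a : Ob) : Set (h ⊔ suc ℓ) where
    field
      _∈ₛ    : Hom a a → Set ℓ
      ∈-id  : id ∈ₛ
      ∈-∘   : ∀ {x y} → x ∈ₛ → y ∈ₛ → (x ∘ y) ∈ₛ
      ∈-⁻¹  : ∀ {x} → x ∈ₛ → (x ⁻¹) ∈ₛ
  open Subgroup public

  _⊆ₛ_ : ∀ {ℓ a} → Subgroup ℓ a → Subgroup ℓ a → Set (h ⊔ ℓ)
  K ⊆ₛ H = ∀ x → (K ∈ₛ) x → (H ∈ₛ) x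

  trivial : ∀ a → Subgroup h a
  trivial a ._∈ₛ x = x ≡ id
  trivial a .∈-id = refl
  trivial a .∈-∘ refl refl = idˡ id
  trivial a .∈-⁻¹ refl = trans (sym (idˡ (id ⁻¹))) (invʳ id)

  -- H = {id_a} (at an arbitrary universe level): H contains only id
  IsTrivial : ∀ {ℓ a} → Subgroup ℓ a → Set (h ⊔ ℓ)
  IsTrivial {a = a} H = ∀ (x : Hom a a) → (H ∈ₛ) x → x ≡ id

  conj : ∀ {ℓ a b} → Hom a b → Subgroup ℓ a → Subgroup ℓ b
  conj g H ._∈ₛ y = (H ∈ₛ) (cj g y)
  conj g H .∈-id = subst (H ∈ₛ) (sym (cj-id g)) (∈-id H)
  conj g H .∈-∘ {x} {y} p q = subst (H ∈ₛ) (sym (cj-∘ g x y)) (∈-∘ H p q)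
  conj g H .∈-⁻¹ {x} p = subst (H ∈ₛ) (sym (cj-⁻¹ g x)) (∈-⁻¹ H p)

  SubgroupFamily : (ℓ k : Level) → Set (o ⊔ h ⊔ suc ℓ ⊔ suc k)
  SubgroupFamily ℓ k = (a : Ob) → Subgroup ℓ a → Set k

  record Kit (ℓ k : Level) : Set (o ⊔ h ⊔ suc ℓ ⊔ suc k) where
    field
      𝒜          : SubgroupFamily ℓ k
      conj-closed : ∀ {a b} (g : Hom a b) (H : Subgroup ℓ a) →
                    𝒜 a H → 𝒜 b (conj g H)

  Orthogonal : ∀ {ℓ a} → Subgroup ℓ a → Subgroup ℓ a → Set (h ⊔ ℓ)
  Orthogonal {a = a} H K = ∀ (x : Hom a a) → (H ∈ₛ) x → (K ∈ₛ) x → x ≡ id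

  -- 𝒜^⊥(a): subgroups orthogonal to every member of 𝒜(a).
  -- (End(a) in 𝔸^op has the same subgroups as in 𝔸, so 𝒜^⊥ is
  --  recorded simply as a family of sets of subgroups of End(a).)
  _^⊥ : ∀ {ℓ k} → SubgroupFamily ℓ k → SubgroupFamily ℓ (h ⊔ suc ℓ ⊔ k)
  _^⊥ {ℓ} 𝒜 a H = ∀ (K : Subgroup ℓ a) → 𝒜 a K → Orthogonal H K

  IsBoolean : ∀ {ℓ k} → Kit ℓ k → Set _
  IsBoolean {ℓ} 𝒦 = ∀ (a : Ob) (H : Subgroup ℓ a) → Kit.𝒜 𝒦 a H ⇔ ((Kit.𝒜 𝒦 ^⊥) ^⊥) a H

  record Directed {ℓ a} {I : Set ℓ} (F : I → Subgroup ℓ a) : Set (h ⊔ ℓ) where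
    field
      inhabited : I
      upper     : ∀ i j → Σ I λ m → (F i ⊆ₛ F m) × (F j ⊆ₛ F m)

  ⋃ : ∀ {ℓ a} {I : Set ℓ} (F : I → Subgroup ℓ a) → Directed F → Subgroup ℓ a
  ⋃ {I = I} F D ._∈ₛ x = Σ I λ i → (F i ∈ₛ) x
  ⋃ F D .∈-id = Directed.inhabited D , ∈-id (F (Directed.inhabited D))
  ⋃ F D .∈-∘ {x} {y} (i , p) (j , q) with Directed.upper D i j
  ... | m , i⊆m , j⊆m = m , ∈-∘ (F m) (i⊆m x p) (j⊆m y q)
  ⋃ F D .∈-⁻¹ (i , p) = i , ∈-⁻¹ (F i) p

module Submission where

open import Defs
open import Level using (Level)
open import Data.Product using (_×_; _,_)
open import Function.Bundles using (Equivalence)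

-- A Boolean kit is an orthogonal complement, 𝒜 = (𝒜^⊥)^⊥, and any orthogonal
-- complement 𝒞^⊥(a) contains {id} and is closed under subgroups and directed
-- unions, since an element of a union already lies in one member of the family.

module _ {o h : Level} (𝔸 : Groupoid o h) {ℓ k : Level}
         (𝒞 : SubgroupFamily 𝔸 ℓ k) (a : Groupoid.Ob 𝔸) where

  ^⊥-⊆-closed : (H K : Subgroup 𝔸 ℓ a) → _⊆ₛ_ 𝔸 K H →
                (_^⊥ 𝔸 𝒞) a H → (_^⊥ 𝔸 𝒞) a K
  ^⊥-⊆-closed H K K⊆H H⊥ L L∈𝒞 x x∈K = H⊥ L L∈𝒞 x (K⊆H x x∈K)

  ^⊥-trivial : (T : Subgroup 𝔸 ℓ a) → IsTrivial 𝔸 T → (_^⊥ 𝔸 𝒞) a T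
  ^⊥-trivial T T-trivial L L∈𝒞 x x∈T x∈L = T-trivial x x∈T

  ^⊥-⋃-closed : (I : Set ℓ) (F : I → Subgroup 𝔸 ℓ a) (D : Directed 𝔸 F) →
                (∀ i → (_^⊥ 𝔸 𝒞) a (F i)) → (_^⊥ 𝔸 𝒞) a (⋃ 𝔸 F D)
  ^⊥-⋃-closed I F D F⊥ L L∈𝒞 x (i , x∈Fi) = F⊥ i L L∈𝒞 x x∈Fi

lemma4p7 : ∀ {o h ℓ k : Level} (𝔸 : Groupoid o h) (𝒦 : Kit 𝔸 ℓ k) →
    IsBoolean 𝔸 𝒦 → (a : Groupoid.Ob 𝔸) →
    ((H K : Subgroup 𝔸 ℓ a) → _⊆ₛ_ 𝔸 K H → Kit.𝒜 𝒦 a H → Kit.𝒜 𝒦 a K)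
    × ((T : Subgroup 𝔸 ℓ a) → IsTrivial 𝔸 T → Kit.𝒜 𝒦 a T)
    × ((I : Set ℓ) (F : I → Subgroup 𝔸 ℓ a) (D : Directed 𝔸 F) →
    (∀ i → Kit.𝒜 𝒦 a (F i)) → Kit.𝒜 𝒦 a (⋃ 𝔸 F D))
lemma4p7 𝔸 𝒦 boolean a =
    (λ H K K⊆H H∈𝒜 → from K (^⊥-⊆-closed 𝔸 𝒜^⊥ a H K K⊆H (to H H∈𝒜)))
  , (λ T T-trivial → from T (^⊥-trivial 𝔸 𝒜^⊥ a T T-trivial))
  , (λ I F D F∈𝒜 → from (⋃ 𝔸 F D)
                          (^⊥-⋃-closed 𝔸 𝒜^⊥ a I F D (λ i → to (F i) (F∈𝒜 i))))
  where
  𝒜^⊥ : SubgroupFamily 𝔸 _ _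
  𝒜^⊥ = _^⊥ 𝔸 (Kit.𝒜 𝒦)

  to : (H : Subgroup 𝔸 _ a) → Kit.𝒜 𝒦 a H → (_^⊥ 𝔸 𝒜^⊥) a H
  to H = Equivalence.to (boolean a H)

  from : (H : Subgroup 𝔸 _ a) → (_^⊥ 𝔸 𝒜^⊥) a H → Kit.𝒜 𝒦 a H
  from H = Equivalence.from (boolean a H)
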